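{- Let $n$ be a positive integer with $n\ge83$, $n\equiv4\pmod5$ and $n\equiv1\pmod6$, and let $H$ be any abelian group of order $n^2+n+1$. Then there are no inverse-closed subsets $T_0,T_1\subseteq H$ with $e\in T_0$ satisfying $T_0T_1=H-e$ and $T_0^2+T_1^2=2H-T_0^{(2)}-T_1^{(2)}+2ne$ in $\mathbb{Z}[H]$.
   Context: $H$ is written multiplicatively with identity $e$; $\mathbb{Z}[H]$ is the integral group ring, a subset $D\subseteq H$ is identified with $\sum_{g\in D}g$, and $H$ also denotes $\sum_{h\in H}h$. For $A=\sum a_gg$ and $t\in\mathbb{Z}$, $A^{(t)}=\sum a_gg^t$. Inverse-closed means $T^{(-1)}=T$. -}

module Defs where

open import Data.Nat using (ℕ; zero; suc)
open import Data.Integer using (ℤ; +_; _+_; _*_; _-_)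
open import Data.Fin using (Fin; _≟_)
open import Data.Fin.Subset using (Subset)
open import Data.Vec using (lookup)
open import Data.Bool using (Bool; true; false; if_then_else_)
open import Relation.Nullary.Decidable using (does)
open import Relation.Binary.PropositionalEquality using (_≡_)
open import Algebra.Core using (Op₁; Op₂)
open import Algebra.Structures using (IsAbelianGroup)

-- A finite abelian group of order N, realised on the carrier Fin N
-- (every abelian group of order N is isomorphic to one of these),
-- with propositional equality.
record FinAbGroup (N : ℕ) : Set where
  field
    _∙_ : Op₂ (Fin N)
    e   : Fin N
    _⁻¹ : Op₁ (Fin N)
    isAbelianGroup : IsAbelianGroup _≡_ _∙_ e _⁻¹

sumFin : (n : ℕ) → (Fin n → ℤ) → ℤ
sumFin zero    f = + 0
sumFin (suc n) f = f Fin.zero + sumFin n (λ i → f (Fin.suc i))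

module GroupRing {N : ℕ} (H : FinAbGroup N) where
  open FinAbGroup H

  ZH : Set
  ZH = Fin N → ℤ

  -- a subset D ⊆ H identified with the group ring element Σ_{g∈D} g
  ⟦_⟧ : Subset N → ZH
  ⟦ D ⟧ g = if lookup D g then + 1 else + 0

  𝟙H : ZH
  𝟙H g = + 1

  δe : ZH
  δe g = if does (g ≟ e) then + 1 else + 0

  infixl 6 _⊕_ _⊖_
  infixl 7 _⊛_ _·_
  infix 4 _≐_
  _·_ : ℤ → ZH → ZH
  (k · A) g = k * A g

  _⊕_ : ZH → ZH → ZH
  (A ⊕ B) g = A g + B g

  _⊖_ : ZH → ZH → ZH
  (A ⊖ B) g = A g - B g

  _⊛_ : ZH → ZH → ZH
  (A ⊛ B) g = sumFin N (λ h → A h * B ((h ⁻¹) ∙ g))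

  -- A^{(t)} = Σ a_h h^t for t = 2: coefficient at g is Σ_{h : h² = g} a_h
  sq⁽²⁾ : ZH → ZH
  sq⁽²⁾ A g = sumFin N (λ h → if does ((h ∙ h) ≟ g) then A h else + 0)

  inv⁽⁻¹⁾ : ZH → ZH
  inv⁽⁻¹⁾ A g = A (g ⁻¹)

  _≐_ : ZH → ZH → Set
  A ≐ B = ∀ g → A g ≡ B g

  InverseClosed : Subset N → Set
  InverseClosed T = inv⁽⁻¹⁾ ⟦ T ⟧ ≐ ⟦ T ⟧

  _∋e : Subset N → Set
  T ∋e = lookup T e ≡ true

-- Write N = n² + n + 1. As n ≡ 1 (mod 3), N = 3 m with m ≡ 1 (mod 3), so 3 ∣ N but 9 ∤ N.
-- Hence H has an element g of order 3 (McKay's proof of Cauchy's theorem), ⟨g⟩ is its only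
-- subgroup of order 3 (another one would yield a subgroup of order 9), and h ↦ h ^ m maps H
-- onto ⟨g⟩ ≅ ℤ₃. Pushing both equations forward to ℤ[ℤ₃] along this surjection ψ, and using
-- that ψ(T₀), ψ(T₁) are inverse-closed, the integers x = ψ(T₀)₀ - ψ(T₀)₁, y = ψ(T₁)₀ - ψ(T₁)₁
-- satisfy x y = -1 and x² + y² + x + y = 2 n. So {x , y} = {1 , -1} and n = 1, contradicting
-- n ≥ 83.
module Submission where

open import Defs
open import Level using (0ℓ)
open import Function using (_∘_; id; _∋_)
open import Data.Bool using (true; false; if_then_else_)
open import Data.Empty using (⊥-elim)
open import Data.Product using (Σ; ∃; ∃₂; _×_; _,_; proj₁; proj₂; uncurry)
import Data.Product
open import Data.Nat as ℕ using (ℕ; zero; suc)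
import Data.Nat.Properties as ℕP
open import Data.Nat.DivMod using (_mod_; m≡m%n+[m/n]*n; [m+kn]%n≡m%n)
open import Data.Nat.Divisibility using (_∣_; ∣m⇒∣m*n)
import Data.Nat.Divisibility as ℕ∣
open import Data.Nat.Tactic.RingSolver renaming (solve-∀ to ℕ-solve-∀)
open import Data.Integer as ℤ using (ℤ; +_; -_; _+_; _-_; _*_)
import Data.Integer.Properties as ℤP
import Data.Integer.Divisibility.Signed as ℤ∣
open import Data.Integer.Tactic.RingSolver using (solve-∀)
open import Data.Fin as Fin using (Fin; _≟_)
import Data.Fin.Properties as FinP
open import Data.Fin.Properties using (all?; any?)
open import Data.Fin.Patterns using (0F; 1F; 2F)
open import Data.Fin.Permutation using (Permutation; permutation)
open import Data.Fin.Subset using (Subset)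
open import Relation.Nullary using (does; ¬_; yes; no; contradiction)
open import Relation.Nullary.Decidable using (dec-true; dec-false; from-yes; decidable-stable; _→-dec_)
open import Relation.Binary.PropositionalEquality
open import Algebra.Bundles using (AbelianGroup)
open import Algebra.Structures using (IsAbelianGroup)
import Algebra.Properties.CommutativeMonoid.Sum
open import Algebra.Properties.Semiring.Sum ℤP.+-*-semiring
  using (sum; sum-cong-≗; ∑-distrib-+; ∑-comm; ∑-permute; *-distribˡ-sum; sum-replicate-zero)

open ≡-Reasoning

sumFin≡sum : ∀ n (f : Fin n → ℤ) → sumFin n f ≡ sum f
sumFin≡sum zero    f = refl
sumFin≡sum (suc n) f = cong (_+_ (f 0F)) (sumFin≡sum n (f ∘ Fin.suc))

sum-const : ∀ n c → sum {n} (λ _ → c) ≡ + n * c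
sum-const zero    c = sym (ℤP.*-zeroˡ c)
sum-const (suc n) c = trans (cong (_+_ c) (sum-const n c)) (sym (ℤP.suc-* (+ n) c))

sum-1 : ∀ n → sum {n} (λ _ → + 1) ≡ + n
sum-1 n = trans (sum-const n (+ 1)) (ℤP.*-identityʳ (+ n))

sum-supported : ∀ {n} (f : Fin n → ℤ) j → (∀ i → i ≢ j → f i ≡ + 0) → sum f ≡ f j
sum-supported {suc n} f 0F       vanish = begin
  f 0F + sum (f ∘ Fin.suc)    ≡⟨ cong (_+_ (f 0F)) (sum-cong-≗ (λ i → vanish (Fin.suc i) λ ())) ⟩
  f 0F + sum {n} (λ _ → + 0)  ≡⟨ cong (_+_ (f 0F)) (sum-replicate-zero n) ⟩
  f 0F + + 0                  ≡⟨ ℤP.+-identityʳ (f 0F) ⟩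
  f 0F                        ∎
sum-supported {suc n} f (Fin.suc j) vanish = begin
  f 0F + sum (f ∘ Fin.suc)  ≡⟨ cong (_+ sum (f ∘ Fin.suc)) (vanish 0F λ ()) ⟩
  + 0 + sum (f ∘ Fin.suc)   ≡⟨ ℤP.+-identityˡ _ ⟩
  sum (f ∘ Fin.suc)         ≡⟨ sum-supported (f ∘ Fin.suc) j
                                 (λ i i≢j → vanish (Fin.suc i) (i≢j ∘ FinP.suc-injective)) ⟩
  f (Fin.suc j)             ∎

sum-neg : ∀ {n} (f : Fin n → ℤ) → sum (λ i → - f i) ≡ - sum f
sum-neg f = begin
  sum (λ i → - f i)        ≡⟨ sum-cong-≗ (λ i → sym (ℤP.-1*i≡-i (f i))) ⟩
  sum (λ i → - + 1 * f i)  ≡⟨ sym (*-distribˡ-sum (- + 1) f) ⟩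
  - + 1 * sum f            ≡⟨ ℤP.-1*i≡-i (sum f) ⟩
  - sum f                  ∎

∑-distrib-- : ∀ {n} (f g : Fin n → ℤ) → sum (λ i → f i - g i) ≡ sum f - sum g
∑-distrib-- f g = trans (∑-distrib-+ f (λ i → - g i)) (cong (_+_ (sum f)) (sum-neg g))

δ : ∀ {n} → Fin n → Fin n → ℤ
δ x y = if does (x ≟ y) then + 1 else + 0

δ-≡ : ∀ {n} {x y : Fin n} → x ≡ y → δ x y ≡ + 1
δ-≡ {x = x} {y} x≡y rewrite dec-true (x ≟ y) x≡y = refl

δ-≢ : ∀ {n} {x y : Fin n} → x ≢ y → δ x y ≡ + 0
δ-≢ {x = x} {y} x≢y rewrite dec-false (x ≟ y) x≢y = refl

δ-cong : ∀ {m n} {x y : Fin m} {u v : Fin n} →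
         (x ≡ y → u ≡ v) → (u ≡ v → x ≡ y) → δ x y ≡ δ u v
δ-cong {x = x} {y} {u} {v} to from with x ≟ y | u ≟ v
... | yes _   | yes _   = refl
... | no  _   | no  _   = refl
... | yes x≡y | no  u≢v = contradiction (to x≡y) u≢v
... | no  x≢y | yes u≡v = contradiction (from u≡v) x≢y

δ-sym : ∀ {n} (x y : Fin n) → δ x y ≡ δ y x
δ-sym x y = δ-cong {x = x} {y} {y} {x} sym sym

if-≟-δ : ∀ {n} (x y : Fin n) a → (if does (x ≟ y) then a else + 0) ≡ a * δ x y
if-≟-δ x y a with does (x ≟ y)
... | true  = sym (ℤP.*-identityʳ a)
... | false = sym (ℤP.*-zeroʳ a)

sum-δ : ∀ {n} (x : Fin n) (f : Fin n → ℤ) → sum (λ y → f y * δ x y) ≡ f x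
sum-δ x f = begin
  sum (λ y → f y * δ x y) ≡⟨ sum-supported _ x (λ y y≢x →
                               trans (cong (f y *_) (δ-≢ (y≢x ∘ sym))) (ℤP.*-zeroʳ (f y))) ⟩
  f x * δ x x             ≡⟨ cong (f x *_) (δ-≡ {x = x} refl) ⟩
  f x * + 1               ≡⟨ ℤP.*-identityʳ (f x) ⟩
  f x                     ∎

module FinAbGroupProperties {N : ℕ} (H : FinAbGroup N) where

  open FinAbGroup H public renaming (_∙_ to infixl 7 _∙_; _⁻¹ to infix 8 _⁻¹)
  open IsAbelianGroup isAbelianGroup public
    using (assoc; comm; identityˡ; identityʳ; inverseˡ; inverseʳ)

  abelianGroup : AbelianGroup 0ℓ 0ℓ
  abelianGroup = record { isAbelianGroup = isAbelianGroup }

  open import Algebra.Properties.AbelianGroup abelianGroup public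
    using (∙-cancelˡ; ∙-cancelʳ; ⁻¹-involutive; ε⁻¹≈ε; inverseˡ-unique; inverseʳ-unique;
           x∙y⁻¹≈ε⇒x≈y; ⁻¹-anti-homo‿-; \\-leftDividesˡ; \\-leftDividesʳ; //-rightDividesˡ)
  open import Algebra.Properties.CommutativeMonoid.Mult (AbelianGroup.commutativeMonoid abelianGroup)
    renaming (_×_ to _·ᴹ_) using (×-homo-+; ×-assocˡ; ×-distrib-+)
  open import Algebra.Properties.CommutativeSemigroup (AbelianGroup.commutativeSemigroup abelianGroup) public
    using (interchange)
  module ∏ = Algebra.Properties.CommutativeMonoid.Sum (AbelianGroup.commutativeMonoid abelianGroup)

  infixr 30 _^_
  _^_ : Fin N → ℕ → Fin N
  h ^ n = n ·ᴹ h

  ^-+ : ∀ h m n → h ^ (m ℕ.+ n) ≡ h ^ m ∙ h ^ n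
  ^-+ h = ×-homo-+ h

  ^-* : ∀ h m n → h ^ (m ℕ.* n) ≡ (h ^ n) ^ m
  ^-* h m n = sym (×-assocˡ h m n)

  ^-distrib : ∀ a b n → (a ∙ b) ^ n ≡ a ^ n ∙ b ^ n
  ^-distrib a b n = ×-distrib-+ a b n

  e^ : ∀ n → e ^ n ≡ e
  e^ zero    = refl
  e^ (suc n) = trans (cong (e ∙_) (e^ n)) (identityˡ e)

  ^-mod : ∀ {h n} .{{_ : ℕ.NonZero n}} → h ^ n ≡ e → ∀ m → h ^ (m ℕ.% n) ≡ h ^ m
  ^-mod {h} {n} hⁿ≡e m = sym (begin
    h ^ m                                   ≡⟨ cong (h ^_) (m≡m%n+[m/n]*n m n) ⟩
    h ^ (m ℕ.% n ℕ.+ (m ℕ./ n) ℕ.* n)       ≡⟨ ^-+ h (m ℕ.% n) _ ⟩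
    h ^ (m ℕ.% n) ∙ h ^ ((m ℕ./ n) ℕ.* n)   ≡⟨ cong (h ^ (m ℕ.% n) ∙_) (^-* h (m ℕ./ n) n) ⟩
    h ^ (m ℕ.% n) ∙ (h ^ n) ^ (m ℕ./ n)     ≡⟨ cong (λ z → h ^ (m ℕ.% n) ∙ z ^ (m ℕ./ n)) hⁿ≡e ⟩
    h ^ (m ℕ.% n) ∙ e ^ (m ℕ./ n)           ≡⟨ cong (h ^ (m ℕ.% n) ∙_) (e^ (m ℕ./ n)) ⟩
    h ^ (m ℕ.% n) ∙ e                       ≡⟨ identityʳ _ ⟩
    h ^ (m ℕ.% n)                           ∎)

  translation : Fin N → Permutation N N
  translation a = permutation (a ∙_) ((a ⁻¹) ∙_) (\\-leftDividesˡ a) (\\-leftDividesʳ a)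

  -- Translating the product of all elements by h multiplies it by h ^ N.
  ^-order≡e : ∀ h → h ^ N ≡ e
  ^-order≡e h = ∙-cancelʳ Π (h ^ N) e (begin
    h ^ N ∙ Π                      ≡⟨ cong (_∙ Π) (sym (∏.sum-replicate N)) ⟩
    ∏.sum {N} (λ _ → h) ∙ Π        ≡⟨ sym (∏.∑-distrib-+ (λ _ → h) (λ x → x)) ⟩
    ∏.sum {N} (λ x → h ∙ x)        ≡⟨ sym (∏.∑-permute (λ x → x) (translation h)) ⟩
    Π                              ≡⟨ sym (identityˡ Π) ⟩
    e ∙ Π                          ∎)
    where
    Π : Fin N
    Π = ∏.sum {N} (λ x → x)

record Hom {M N : ℕ} (H : FinAbGroup M) (G : FinAbGroup N) : Set where
  private
    module H = FinAbGroup H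
    module G = FinAbGroup G
  field
    to   : Fin M → Fin N
    homo : ∀ a b → to (a H.∙ b) ≡ to a G.∙ to b

module HomProperties {M N} {H : FinAbGroup M} {G : FinAbGroup N} (ψ : Hom H G) where
  private
    module H = FinAbGroupProperties H
    module G = FinAbGroupProperties G
  open Hom ψ

  to-e : to H.e ≡ G.e
  to-e = G.∙-cancelˡ (to H.e) (to H.e) G.e (begin
    to H.e G.∙ to H.e  ≡⟨ sym (homo H.e H.e) ⟩
    to (H.e H.∙ H.e)   ≡⟨ cong to (H.identityˡ H.e) ⟩
    to H.e             ≡⟨ sym (G.identityʳ (to H.e)) ⟩
    to H.e G.∙ G.e     ∎)

  to-⁻¹ : ∀ a → to (a H.⁻¹) ≡ to a G.⁻¹
  to-⁻¹ a = G.inverseˡ-unique (to (a H.⁻¹)) (to a)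
    (trans (sym (homo (a H.⁻¹) a)) (trans (cong to (H.inverseˡ a)) to-e))

  trivial-kernel⇒injective : (∀ a → to a ≡ G.e → a ≡ H.e) → ∀ a b → to a ≡ to b → a ≡ b
  trivial-kernel⇒injective trivial a b ψa≡ψb = H.x∙y⁻¹≈ε⇒x≈y a b (trivial (a H.∙ b H.⁻¹) (begin
    to (a H.∙ b H.⁻¹)       ≡⟨ homo a (b H.⁻¹) ⟩
    to a G.∙ to (b H.⁻¹)    ≡⟨ cong₂ G._∙_ ψa≡ψb (to-⁻¹ b) ⟩
    to b G.∙ to b G.⁻¹      ≡⟨ G.inverseʳ (to b) ⟩
    G.e                     ∎))

isAbelianGroup-≡ : ∀ {N} (_∙_ : Fin N → Fin N → Fin N) (e : Fin N) (_⁻¹ : Fin N → Fin N) →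
  (∀ x y z → (x ∙ y) ∙ z ≡ x ∙ (y ∙ z)) → (∀ x → e ∙ x ≡ x) →
  (∀ x → (x ⁻¹) ∙ x ≡ e) → (∀ x y → x ∙ y ≡ y ∙ x) → IsAbelianGroup _≡_ _∙_ e _⁻¹
isAbelianGroup-≡ _∙_ e _⁻¹ assoc identityˡ inverseˡ comm = record
  { isGroup = record
    { isMonoid = record
      { isSemigroup = record
        { isMagma = record { isEquivalence = isEquivalence ; ∙-cong = cong₂ _∙_ }
        ; assoc = assoc }
      ; identity = identityˡ , λ x → trans (comm x e) (identityˡ x) }
    ; inverse = inverseˡ , λ x → trans (comm x (x ⁻¹)) (inverseˡ x)
    ; ⁻¹-cong = cong _⁻¹ }
  ; comm = comm }

infixl 6 _+₃_
_+₃_ : Fin 3 → Fin 3 → Fin 3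
i +₃ j = (Fin.toℕ i ℕ.+ Fin.toℕ j) mod 3

-₃_ : Fin 3 → Fin 3
-₃ i = (3 ℕ.∸ Fin.toℕ i) mod 3

ℤ₃ : FinAbGroup 3
ℤ₃ = record
  { _∙_ = _+₃_ ; e = 0F ; _⁻¹ = -₃_
  ; isAbelianGroup = isAbelianGroup-≡ _+₃_ 0F -₃_
      (from-yes (all? λ i → all? λ j → all? λ k → (i +₃ j) +₃ k ≟ i +₃ (j +₃ k)))
      (from-yes (all? λ i → 0F +₃ i ≟ i))
      (from-yes (all? λ i → (-₃ i) +₃ i ≟ 0F))
      (from-yes (all? λ i → all? λ j → i +₃ j ≟ j +₃ i)) }

toℕ-+₃ : ∀ i j → Fin.toℕ (i +₃ j) ≡ (Fin.toℕ i ℕ.+ Fin.toℕ j) ℕ.% 3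
toℕ-+₃ i j = FinP.toℕ-fromℕ< _

module Product {m n} (G : FinAbGroup m) (K : FinAbGroup n) where
  private
    module G = FinAbGroupProperties G
    module K = FinAbGroupProperties K

  split : Fin (m ℕ.* n) → Fin m × Fin n
  split = Fin.remQuot n

  join : Fin m × Fin n → Fin (m ℕ.* n)
  join = uncurry Fin.combine

  split-join : ∀ p → split (join p) ≡ p
  split-join (a , b) = FinP.remQuot-combine a b

  join-split : ∀ x → join (split x) ≡ x
  join-split = FinP.combine-remQuot {m} n

  _∙ₚ_ : Fin m × Fin n → Fin m × Fin n → Fin m × Fin n
  (a , b) ∙ₚ (a′ , b′) = a G.∙ a′ , b K.∙ b′

  _∙_ : Fin (m ℕ.* n) → Fin (m ℕ.* n) → Fin (m ℕ.* n)
  x ∙ y = join (split x ∙ₚ split y)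

  e : Fin (m ℕ.* n)
  e = join (G.e , K.e)

  _⁻¹ : Fin (m ℕ.* n) → Fin (m ℕ.* n)
  x ⁻¹ = join (Data.Product.map G._⁻¹ K._⁻¹ (split x))

  split-∙ : ∀ x y → split (x ∙ y) ≡ split x ∙ₚ split y
  split-∙ x y = split-join _

  group : FinAbGroup (m ℕ.* n)
  group = record
    { _∙_ = _∙_ ; e = e ; _⁻¹ = _⁻¹
    ; isAbelianGroup = isAbelianGroup-≡ _∙_ e _⁻¹ assoc identityˡ inverseˡ comm }
    where
    assoc : ∀ x y z → (x ∙ y) ∙ z ≡ x ∙ (y ∙ z)
    assoc x y z = cong join (trans (cong (_∙ₚ split z) (split-join _))
      (trans (cong₂ _,_ (G.assoc _ _ _) (K.assoc _ _ _)) (cong (split x ∙ₚ_) (sym (split-join _)))))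
    identityˡ : ∀ x → e ∙ x ≡ x
    identityˡ x = trans (cong (λ p → join (p ∙ₚ split x)) (split-join _))
      (trans (cong join (cong₂ _,_ (G.identityˡ _) (K.identityˡ _))) (join-split x))
    inverseˡ : ∀ x → (x ⁻¹) ∙ x ≡ e
    inverseˡ x = cong join
      (trans (cong (_∙ₚ split x) (split-join _)) (cong₂ _,_ (G.inverseˡ _) (K.inverseˡ _)))
    comm : ∀ x y → x ∙ y ≡ y ∙ x
    comm x y = cong join (cong₂ _,_ (G.comm _ _) (K.comm _ _))

module OrderThree {N} (H : FinAbGroup N) (g : Fin N) where
  open FinAbGroupProperties H

  module _ (g³≡e : g ^ 3 ≡ e) where

    powers : Hom ℤ₃ H
    powers = record { to = λ i → g ^ Fin.toℕ i ; homo = homo }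
      where
      homo : ∀ i j → g ^ Fin.toℕ (i +₃ j) ≡ g ^ Fin.toℕ i ∙ g ^ Fin.toℕ j
      homo i j = begin
        g ^ Fin.toℕ (i +₃ j)                      ≡⟨ cong (g ^_) (toℕ-+₃ i j) ⟩
        g ^ ((Fin.toℕ i ℕ.+ Fin.toℕ j) ℕ.% 3)     ≡⟨ ^-mod {g} {3} g³≡e (Fin.toℕ i ℕ.+ Fin.toℕ j) ⟩
        g ^ (Fin.toℕ i ℕ.+ Fin.toℕ j)             ≡⟨ ^-+ g (Fin.toℕ i) (Fin.toℕ j) ⟩
        g ^ Fin.toℕ i ∙ g ^ Fin.toℕ j             ∎

    powers-injective : g ≢ e → ∀ i j → g ^ Fin.toℕ i ≡ g ^ Fin.toℕ j → i ≡ j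
    powers-injective g≢e = HomProperties.trivial-kernel⇒injective powers trivialKernel
      where
      trivialKernel : ∀ i → g ^ Fin.toℕ i ≡ e → i ≡ 0F
      trivialKernel 0F _    = refl
      trivialKernel 1F g¹≡e = contradiction (trans (sym (identityʳ g)) g¹≡e) g≢e
      trivialKernel 2F g²≡e =
        contradiction (trans (sym (identityʳ g)) (trans (cong (g ∙_) (sym g²≡e)) g³≡e)) g≢e

-- Orbit counting, Lagrange's theorem, and Cauchy's theorem for the prime 3

least : ∀ {k M} → (Fin (suc k) → Fin M) → Fin M
least {zero}  f = f 0F
least {suc k} f with Fin.toℕ (f 0F) ℕ.≤? Fin.toℕ (least (f ∘ Fin.suc))
... | yes _ = f 0F
... | no  _ = least (f ∘ Fin.suc)

least-attained : ∀ {k M} (f : Fin (suc k) → Fin M) → ∃ λ i → least f ≡ f i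
least-attained {zero}  f = 0F , refl
least-attained {suc k} f with Fin.toℕ (f 0F) ℕ.≤? Fin.toℕ (least (f ∘ Fin.suc))
... | yes _ = 0F , refl
... | no  _ = let i , eq = least-attained (f ∘ Fin.suc) in Fin.suc i , eq

least-≤ : ∀ {k M} (f : Fin (suc k) → Fin M) i → Fin.toℕ (least f) ℕ.≤ Fin.toℕ (f i)
least-≤ {zero}  f 0F = ℕP.≤-refl
least-≤ {suc k} f i with Fin.toℕ (f 0F) ℕ.≤? Fin.toℕ (least (f ∘ Fin.suc))
least-≤ {suc k} f 0F          | yes _ = ℕP.≤-refl
least-≤ {suc k} f (Fin.suc i) | yes p = ℕP.≤-trans p (least-≤ (f ∘ Fin.suc) i)
least-≤ {suc k} f 0F          | no ¬p = ℕP.<⇒≤ (ℕP.≰⇒> ¬p)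
least-≤ {suc k} f (Fin.suc i) | no _  = least-≤ (f ∘ Fin.suc) i

module OrbitCounting {k M} (G : FinAbGroup (suc k)) (act : Fin (suc k) → Fin M → Fin M)
  (act-e : ∀ x → act (FinAbGroup.e G) x ≡ x)
  (act-∙ : ∀ a b x → act (FinAbGroup._∙_ G a b) x ≡ act a (act b x)) where
  open FinAbGroupProperties G

  act-permutation : Fin (suc k) → Permutation M M
  act-permutation a = permutation (act a) (act (a ⁻¹)) (cancel (inverseʳ a)) (cancel (inverseˡ a))
    where
    cancel : ∀ {b c} → b ∙ c ≡ e → ∀ x → act b (act c x) ≡ x
    cancel bc≡e x = trans (sym (act-∙ _ _ x)) (trans (cong (λ a → act a x) bc≡e) (act-e x))

  rep : Fin M → Fin M
  rep x = least (λ a → act a x)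

  rep-act : ∀ a x → rep (act a x) ≡ rep x
  rep-act a x = FinP.toℕ-injective (ℕP.≤-antisym rep[ax]≤rep[x] rep[x]≤rep[ax])
    where
    rep[ax]≤rep[x] : Fin.toℕ (rep (act a x)) ℕ.≤ Fin.toℕ (rep x)
    rep[ax]≤rep[x] with b , rep≡ ← least-attained (λ b → act b x) =
      subst (λ y → Fin.toℕ (rep (act a x)) ℕ.≤ Fin.toℕ y)
        (trans (sym (act-∙ _ a x)) (trans (cong (λ c → act c x) (//-rightDividesˡ a b)) (sym rep≡)))
        (least-≤ (λ c → act c (act a x)) (b ∙ (a ⁻¹)))
    rep[x]≤rep[ax] : Fin.toℕ (rep x) ℕ.≤ Fin.toℕ (rep (act a x))
    rep[x]≤rep[ax] with b , rep≡ ← least-attained (λ b → act b (act a x)) =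
      subst (λ y → Fin.toℕ (rep x) ℕ.≤ Fin.toℕ y)
        (trans (act-∙ b a x) (sym rep≡))
        (least-≤ (λ c → act c x) (b ∙ a))

  module _ (w : Fin M → ℤ) (w-invariant : ∀ a x → w (act a x) ≡ w x)
           (free : ∀ x → w x ≢ + 0 → ∀ a b → act a x ≡ act b x → a ≡ b) where

    hits-rep-once : ∀ x → w x ≢ + 0 → sum (λ a → δ (act a x) (rep x)) ≡ + 1
    hits-rep-once x wx≢0 with b , rep≡ ← least-attained (λ b → act b x) =
      trans (sum-supported _ b (λ a a≢b → δ-≢ (λ eq → a≢b (free x wx≢0 a b (trans eq rep≡)))))
            (δ-≡ (sym rep≡))

    weigh-by-hits : ∀ x → w x ≡ w x * sum (λ a → δ (act a x) (rep x))
    weigh-by-hits x with w x ℤ.≟ + 0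
    ... | yes wx≡0 = trans wx≡0 (sym (trans (cong (_* hits) wx≡0) (ℤP.*-zeroˡ hits)))
      where
      hits : ℤ
      hits = sum {suc k} (λ a → δ (act a x) (rep x))
    ... | no  wx≢0 = sym (trans (cong (_*_ (w x)) (hits-rep-once x wx≢0)) (ℤP.*-identityʳ (w x)))

    order∣sum : + suc k ℤ∣.∣ sum w
    order∣sum = ℤ∣.divides R (begin
      sum w
        ≡⟨ sum-cong-≗ weigh-by-hits ⟩
      sum (λ x → w x * sum (λ a → δ (act a x) (rep x)))
        ≡⟨ sum-cong-≗ (λ x → *-distribˡ-sum (w x) (λ a → δ (act a x) (rep x))) ⟩
      sum (λ x → sum (λ a → w x * δ (act a x) (rep x)))
        ≡⟨ ∑-comm {M} {suc k} (λ x a → w x * δ (act a x) (rep x)) ⟩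
      sum (λ a → sum (λ x → w x * δ (act a x) (rep x)))
        ≡⟨ sum-cong-≗ (λ a → sum-cong-≗ (λ x →
             cong₂ (λ u r → u * δ (act a x) r) (sym (w-invariant a x)) (sym (rep-act a x)))) ⟩
      sum (λ a → sum (λ x → w (act a x) * δ (act a x) (rep (act a x))))
        ≡⟨ sum-cong-≗ (λ a → sym (∑-permute (λ y → w y * δ y (rep y)) (act-permutation a))) ⟩
      sum {suc k} (λ _ → R)
        ≡⟨ sum-const (suc k) R ⟩
      + suc k * R
        ≡⟨ ℤP.*-comm (+ suc k) R ⟩
      R * + suc k ∎)
      where
      R : ℤ
      R = sum (λ y → w y * δ y (rep y))

module _ {k N} {G : FinAbGroup (suc k)} {H : FinAbGroup N} (φ : Hom G H) where
  private
    module G = FinAbGroupProperties G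
  open FinAbGroupProperties H
  open Hom φ
  open HomProperties φ

  embedding-order∣ : (∀ a b → to a ≡ to b → a ≡ b) → suc k ∣ N
  embedding-order∣ injective = ℤ∣.∣⇒∣ᵤ (subst (+ suc k ℤ∣.∣_) (sum-1 N)
    (OrbitCounting.order∣sum G act act-e act-∙ (λ _ → + 1) (λ _ _ → refl)
      (λ x _ a b ax≡bx → injective a b (∙-cancelʳ x (to a) (to b) ax≡bx))))
    where
    act : Fin (suc k) → Fin N → Fin N
    act a x = to a ∙ x
    act-e : ∀ x → act G.e x ≡ x
    act-e x = trans (cong (_∙ x) to-e) (identityˡ x)
    act-∙ : ∀ a b x → act (a G.∙ b) x ≡ act a (act b x)
    act-∙ a b x = trans (cong (_∙ x) (homo a b)) (assoc (to a) (to b) x)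

-- McKay's argument: ℤ₃ acts on the pairs (a , b), read as the triples (a , b , (a ∙ b) ⁻¹)
-- with product e, by cyclic rotation; the fixed points are the (a , a) with a ^ 3 ≡ e.
module Cauchy₃ {N} (H : FinAbGroup N) where
  open FinAbGroupProperties H
  open Product H H using (split; join; split-join; join-split)

  rotate : Fin N × Fin N → Fin N × Fin N
  rotate (a , b) = b , (a ∙ b) ⁻¹

  ∙[∙]⁻¹ : ∀ a b → b ∙ (a ∙ b) ⁻¹ ≡ a ⁻¹
  ∙[∙]⁻¹ a b = inverseʳ-unique a (b ∙ (a ∙ b) ⁻¹) (trans (sym (assoc a b _)) (inverseʳ (a ∙ b)))

  rotate³ : ∀ p → rotate (rotate (rotate p)) ≡ p
  rotate³ (a , b) = cong₂ _,_ first (begin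
    ((a ∙ b) ⁻¹ ∙ (b ∙ (a ∙ b) ⁻¹) ⁻¹) ⁻¹  ≡⟨ cong (λ c → ((a ∙ b) ⁻¹ ∙ c) ⁻¹) first ⟩
    ((a ∙ b) ⁻¹ ∙ a) ⁻¹                    ≡⟨ cong _⁻¹ (comm _ a) ⟩
    (a ∙ (a ∙ b) ⁻¹) ⁻¹                    ≡⟨ cong (λ c → (a ∙ c ⁻¹) ⁻¹) (comm a b) ⟩
    (a ∙ (b ∙ a) ⁻¹) ⁻¹                    ≡⟨ cong _⁻¹ (∙[∙]⁻¹ b a) ⟩
    (b ⁻¹) ⁻¹                              ≡⟨ ⁻¹-involutive b ⟩
    b                                      ∎)
    where
    first : (b ∙ (a ∙ b) ⁻¹) ⁻¹ ≡ a
    first = trans (cong _⁻¹ (∙[∙]⁻¹ a b)) (⁻¹-involutive a)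

  σ : Fin (N ℕ.* N) → Fin (N ℕ.* N)
  σ = join ∘ rotate ∘ split

  σ³ : ∀ x → σ (σ (σ x)) ≡ x
  σ³ x = begin
    join (rotate (split (join (rotate (split (join (rotate (split x))))))))
      ≡⟨ cong (λ p → join (rotate (split (join (rotate p))))) (split-join _) ⟩
    join (rotate (split (join (rotate (rotate (split x))))))
      ≡⟨ cong (join ∘ rotate) (split-join _) ⟩
    join (rotate (rotate (rotate (split x))))
      ≡⟨ cong join (rotate³ (split x)) ⟩
    join (split x)
      ≡⟨ join-split x ⟩
    x ∎

  act : Fin 3 → Fin (N ℕ.* N) → Fin (N ℕ.* N)
  act 0F = id
  act 1F = σ
  act 2F = σ ∘ σ

  act-∙ : ∀ i j x → act (i +₃ j) x ≡ act i (act j x)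
  act-∙ 0F 0F x = refl
  act-∙ 0F 1F x = refl
  act-∙ 0F 2F x = refl
  act-∙ 1F 0F x = refl
  act-∙ 1F 1F x = refl
  act-∙ 1F 2F x = sym (σ³ x)
  act-∙ 2F 0F x = refl
  act-∙ 2F 1F x = sym (σ³ x)
  act-∙ 2F 2F x = sym (cong σ (σ³ x))

  fixed : Fin (N ℕ.* N) → ℤ
  fixed x = δ (σ x) x

  moved : Fin (N ℕ.* N) → ℤ
  moved x = + 1 - fixed x

  σ-fixed-back : ∀ x → σ (σ x) ≡ σ x → σ x ≡ x
  σ-fixed-back x σσx≡σx = trans (sym (σ³ (σ x))) (trans (cong (σ ∘ σ) σσx≡σx) (σ³ x))

  moved-σ : ∀ x → moved (σ x) ≡ moved x
  moved-σ x = cong (_-_ (+ 1)) (δ-cong (σ-fixed-back x) (cong σ))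

  moved-act : ∀ i x → moved (act i x) ≡ moved x
  moved-act 0F x = refl
  moved-act 1F x = moved-σ x
  moved-act 2F x = trans (moved-σ (σ x)) (moved-σ x)

  moved⇒σ≢id : ∀ x → moved x ≢ + 0 → σ x ≢ x
  moved⇒σ≢id x moved≢0 σx≡x = moved≢0 (cong (_-_ (+ 1)) (δ-≡ σx≡x))

  act-free : ∀ x → moved x ≢ + 0 → ∀ i j → act i x ≡ act j x → i ≡ j
  act-free x moved≢0 = free
    where
    σ≢id : σ x ≢ x
    σ≢id = moved⇒σ≢id x moved≢0
    free : ∀ i j → act i x ≡ act j x → i ≡ j
    free 0F 0F _  = refl
    free 0F 1F eq = contradiction (sym eq) σ≢id
    free 0F 2F eq = contradiction (trans (cong σ eq) (σ³ x)) σ≢id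
    free 1F 0F eq = contradiction eq σ≢id
    free 1F 1F _  = refl
    free 1F 2F eq = contradiction (σ-fixed-back x (sym eq)) σ≢id
    free 2F 0F eq = contradiction (trans (cong σ (sym eq)) (σ³ x)) σ≢id
    free 2F 1F eq = contradiction (σ-fixed-back x eq) σ≢id
    free 2F 2F _  = refl

  3∣moved : + 3 ℤ∣.∣ sum moved
  3∣moved = OrbitCounting.order∣sum ℤ₃ act (λ _ → refl) act-∙ moved moved-act act-free

  3∣fixed : 3 ∣ N → + 3 ℤ∣.∣ sum fixed
  3∣fixed 3∣N =
    ℤ∣.∣m+n∣m⇒∣n (subst (+ 3 ℤ∣.∣_) pairs≡moved+fixed (ℤ∣.∣ᵤ⇒∣ (∣m⇒∣m*n N 3∣N))) 3∣moved
    where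
    pairs≡moved+fixed : + (N ℕ.* N) ≡ sum moved + sum fixed
    pairs≡moved+fixed = begin
      + (N ℕ.* N)                           ≡⟨ sym (sum-1 (N ℕ.* N)) ⟩
      sum {N ℕ.* N} (λ _ → + 1)             ≡⟨ sum-cong-≗ (λ x → sym (m-n+n≡m (+ 1) (fixed x))) ⟩
      sum (λ x → moved x + fixed x)         ≡⟨ ∑-distrib-+ moved fixed ⟩
      sum moved + sum fixed                 ∎
      where
      m-n+n≡m : ∀ m n → m - n + n ≡ m
      m-n+n≡m = solve-∀

  x₀ : Fin (N ℕ.* N)
  x₀ = join (e , e)

  σx₀≡x₀ : σ x₀ ≡ x₀
  σx₀≡x₀ = trans (cong (join ∘ rotate) (split-join (e , e)))
                 (cong (λ c → join (e , c)) (trans (cong _⁻¹ (identityˡ e)) ε⁻¹≈ε))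

  x₀-not-only-fixed-point : 3 ∣ N → ¬ (∀ x → σ x ≡ x → x ≡ x₀)
  x₀-not-only-fixed-point 3∣N only-x₀ =
    contradiction (ℕ∣.∣1⇒≡1 (ℤ∣.∣⇒∣ᵤ (subst (+ 3 ℤ∣.∣_) fixed≡1 (3∣fixed 3∣N)))) λ ()
    where
    fixed≡1 : sum fixed ≡ + 1
    fixed≡1 = trans (sum-supported fixed x₀ (λ x x≢x₀ → δ-≢ (x≢x₀ ∘ only-x₀ x))) (δ-≡ σx₀≡x₀)

  other-fixed-point : 3 ∣ N → ∃ λ x → σ x ≡ x × x ≢ x₀
  other-fixed-point 3∣N = Data.Product.map₂ (λ {x} → fixed-but-not-x₀ x)
    (FinP.¬∀⟶∃¬ (N ℕ.* N) (λ x → σ x ≡ x → x ≡ x₀) (λ x → (σ x ≟ x) →-dec (x ≟ x₀))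
      (x₀-not-only-fixed-point 3∣N))
    where
    fixed-but-not-x₀ : ∀ x → ¬ (σ x ≡ x → x ≡ x₀) → σ x ≡ x × x ≢ x₀
    fixed-but-not-x₀ x ¬[fixed⇒x₀] =
      decidable-stable (σ x ≟ x) (λ σx≢x → ¬[fixed⇒x₀] (λ σx≡x → contradiction σx≡x σx≢x)) ,
      λ x≡x₀ → ¬[fixed⇒x₀] (λ _ → x≡x₀)

  fixed-point⇒order-3 : ∀ x → σ x ≡ x → x ≢ x₀ → ∃ λ g → g ≢ e × g ^ 3 ≡ e
  fixed-point⇒order-3 x σx≡x x≢x₀ = a , a≢e , a³≡e
    where
    a b : Fin N
    a = proj₁ (split x)
    b = proj₂ (split x)
    rotated : (b , (a ∙ b) ⁻¹) ≡ (a , b)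
    rotated = trans (sym (split-join _)) (cong split σx≡x)
    b≡a : b ≡ a
    b≡a = cong proj₁ rotated
    [a∙a]⁻¹≡a : (a ∙ a) ⁻¹ ≡ a
    [a∙a]⁻¹≡a = trans (cong (λ c → (a ∙ c) ⁻¹) (sym b≡a)) (trans (cong proj₂ rotated) b≡a)
    a³≡e : a ^ 3 ≡ e
    a³≡e = begin
      a ∙ (a ∙ (a ∙ e))    ≡⟨ cong (λ c → a ∙ (a ∙ c)) (identityʳ a) ⟩
      a ∙ (a ∙ a)          ≡⟨ cong (_∙ (a ∙ a)) (sym [a∙a]⁻¹≡a) ⟩
      (a ∙ a) ⁻¹ ∙ (a ∙ a) ≡⟨ inverseˡ (a ∙ a) ⟩
      e                    ∎
    a≢e : a ≢ e
    a≢e a≡e = x≢x₀ (trans (sym (join-split x)) (cong join (cong₂ _,_ a≡e (trans b≡a a≡e))))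

  cauchy₃ : 3 ∣ N → ∃ λ g → g ≢ e × g ^ 3 ≡ e
  cauchy₃ 3∣N = let x , σx≡x , x≢x₀ = other-fixed-point 3∣N in fixed-point⇒order-3 x σx≡x x≢x₀

module _ {N} {H : FinAbGroup N} where
  open FinAbGroupProperties H
  open Product ℤ₃ ℤ₃ using (split; join; join-split; split-∙) renaming (group to ℤ₃²)
  private module ℤ₃² = FinAbGroup ℤ₃²

  independent-pair : ∀ g y → g ≢ e → g ^ 3 ≡ e → y ^ 3 ≡ e → (∀ i → g ^ Fin.toℕ i ≢ y) →
    Σ (Hom ℤ₃² H) λ φ → ∀ a b → Hom.to φ a ≡ Hom.to φ b → a ≡ b
  independent-pair g y g≢e g³≡e y³≡e y∉⟨g⟩ = φ , HomProperties.trivial-kernel⇒injective φ trivialKernel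
    where
    ⟨g⟩ ⟨y⟩ : Hom ℤ₃ H
    ⟨g⟩ = OrderThree.powers H g g³≡e
    ⟨y⟩ = OrderThree.powers H y y³≡e
    open Hom ⟨g⟩ renaming (to to g^; homo to g^-homo)
    open Hom ⟨y⟩ renaming (to to y^; homo to y^-homo)
    φ : Hom ℤ₃² H
    φ = record
      { to   = λ x → g^ (proj₁ (split x)) ∙ y^ (proj₂ (split x))
      ; homo = homo }
      where
      homo : ∀ x x′ → g^ (proj₁ (split (x ℤ₃².∙ x′))) ∙ y^ (proj₂ (split (x ℤ₃².∙ x′)))
                    ≡ (g^ (proj₁ (split x)) ∙ y^ (proj₂ (split x)))
                      ∙ (g^ (proj₁ (split x′)) ∙ y^ (proj₂ (split x′)))
      homo x x′ = begin
        g^ (proj₁ (split (x ℤ₃².∙ x′))) ∙ y^ (proj₂ (split (x ℤ₃².∙ x′)))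
          ≡⟨ cong (λ p → g^ (proj₁ p) ∙ y^ (proj₂ p)) (split-∙ x x′) ⟩
        g^ (i +₃ i′) ∙ y^ (j +₃ j′)        ≡⟨ cong₂ _∙_ (g^-homo i i′) (y^-homo j j′) ⟩
        (g^ i ∙ g^ i′) ∙ (y^ j ∙ y^ j′)    ≡⟨ interchange (g^ i) (g^ i′) (y^ j) (y^ j′) ⟩
        (g^ i ∙ y^ j) ∙ (g^ i′ ∙ y^ j′)    ∎
        where
        i j i′ j′ : Fin 3
        i = proj₁ (split x) ; j = proj₂ (split x) ; i′ = proj₁ (split x′) ; j′ = proj₂ (split x′)
    g⁻ⁱ≡yʲ : ∀ i j → g^ i ∙ y^ j ≡ e → g^ (-₃ i) ≡ y^ j
    g⁻ⁱ≡yʲ i j gⁱyʲ≡e = trans (HomProperties.to-⁻¹ ⟨g⟩ i) (sym (inverseʳ-unique _ _ gⁱyʲ≡e))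
    kernel : ∀ i j → g^ i ∙ y^ j ≡ e → (i , j) ≡ (0F , 0F)
    kernel i 0F gⁱ∙e≡e = cong (λ k → Fin 3 × Fin 3 ∋ (k , 0F))
      (OrderThree.powers-injective H g g³≡e g≢e i 0F (trans (sym (identityʳ (g^ i))) gⁱ∙e≡e))
    kernel i 1F gⁱyʲ≡e = ⊥-elim (y∉⟨g⟩ (-₃ i) (trans (g⁻ⁱ≡yʲ i 1F gⁱyʲ≡e) (identityʳ y)))
    kernel i 2F gⁱyʲ≡e = ⊥-elim (y∉⟨g⟩ (-₃ i +₃ -₃ i) (begin
      g^ (-₃ i +₃ -₃ i)     ≡⟨ g^-homo (-₃ i) (-₃ i) ⟩
      g^ (-₃ i) ∙ g^ (-₃ i) ≡⟨ cong₂ _∙_ (g⁻ⁱ≡yʲ i 2F gⁱyʲ≡e) (g⁻ⁱ≡yʲ i 2F gⁱyʲ≡e) ⟩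
      y^ 2F ∙ y^ 2F         ≡⟨ sym (y^-homo 2F 2F) ⟩
      y ∙ e                 ≡⟨ identityʳ y ⟩
      y                     ∎))
    trivialKernel : ∀ x → Hom.to φ x ≡ e → x ≡ FinAbGroup.e ℤ₃²
    trivialKernel x φx≡e =
      trans (sym (join-split x)) (cong join (kernel (proj₁ (split x)) (proj₂ (split x)) φx≡e))

-- A surjection H → ℤ₃ when |H| = 3 m with m ≡ 1 (mod 3)

module ProjectionOntoℤ₃ {N} (H : FinAbGroup N) {m : ℕ} (N≡3m : N ≡ 3 ℕ.* m) (m%3≡1 : m ℕ.% 3 ≡ 1) where
  open FinAbGroupProperties H

  9∤N : ¬ 9 ∣ N
  9∤N 9∣N =
    contradiction (trans (sym m%3≡1) (ℕ∣.n∣m⇒m%n≡0 m 3 (ℕ∣.*-cancelˡ-∣ 3 (subst (9 ∣_) N≡3m 9∣N)))) λ ()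

  3∣N : 3 ∣ N
  3∣N = ℕ∣.divides m (trans N≡3m (ℕP.*-comm 3 m))

  element-of-order-3 : ∃ λ g → g ≢ e × g ^ 3 ≡ e
  element-of-order-3 = Cauchy₃.cauchy₃ H 3∣N

  g : Fin N
  g = proj₁ element-of-order-3

  g≢e : g ≢ e
  g≢e = proj₁ (proj₂ element-of-order-3)

  g³≡e : g ^ 3 ≡ e
  g³≡e = proj₂ (proj₂ element-of-order-3)

  ⟨g⟩ : Hom ℤ₃ H
  ⟨g⟩ = OrderThree.powers H g g³≡e
  open Hom ⟨g⟩ renaming (to to g^; homo to g^-homo)

  g^-injective : ∀ i j → g^ i ≡ g^ j → i ≡ j
  g^-injective = OrderThree.powers-injective H g g³≡e g≢e

  cube-root∈⟨g⟩ : ∀ y → y ^ 3 ≡ e → ∃ λ i → g^ i ≡ y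
  cube-root∈⟨g⟩ y y³≡e = decidable-stable (any? λ i → g^ i ≟ y) λ y∉⟨g⟩ →
    let φ , φ-injective = independent-pair {H = H} g y g≢e g³≡e y³≡e (λ i gⁱ≡y → y∉⟨g⟩ (i , gⁱ≡y)) in
    9∤N (embedding-order∣ φ φ-injective)

  [h^m]³≡e : ∀ h → (h ^ m) ^ 3 ≡ e
  [h^m]³≡e h = trans (sym (^-* h 3 m)) (trans (cong (h ^_) (sym N≡3m)) (^-order≡e h))

  ψ : Fin N → Fin 3
  ψ h = proj₁ (cube-root∈⟨g⟩ (h ^ m) ([h^m]³≡e h))

  g^ψ : ∀ h → g^ (ψ h) ≡ h ^ m
  g^ψ h = proj₂ (cube-root∈⟨g⟩ (h ^ m) ([h^m]³≡e h))

  projection : Hom H ℤ₃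
  projection = record { to = ψ ; homo = λ a b → g^-injective _ _ (begin
    g^ (ψ (a ∙ b))      ≡⟨ g^ψ (a ∙ b) ⟩
    (a ∙ b) ^ m         ≡⟨ ^-distrib a b m ⟩
    a ^ m ∙ b ^ m       ≡⟨ sym (cong₂ _∙_ (g^ψ a) (g^ψ b)) ⟩
    g^ (ψ a) ∙ g^ (ψ b) ≡⟨ sym (g^-homo (ψ a) (ψ b)) ⟩
    g^ (ψ a +₃ ψ b)     ∎) }

  ψg≡1 : ψ g ≡ 1F
  ψg≡1 = g^-injective _ _ (begin
    g^ (ψ g)         ≡⟨ g^ψ g ⟩
    g ^ m            ≡⟨ sym (^-mod g³≡e m) ⟩
    g ^ (m ℕ.% 3)    ≡⟨ cong (g ^_) m%3≡1 ⟩
    g ^ 1            ∎)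

  projection-surjective : ∀ u → ∃ λ a → ψ a ≡ u
  projection-surjective 0F = e , HomProperties.to-e projection
  projection-surjective 1F = g , ψg≡1
  projection-surjective 2F = g ∙ g , trans (Hom.homo projection g g) (cong₂ _+₃_ ψg≡1 ψg≡1)

-- Pushforward along maps of finite sets, and along homomorphisms of group rings

sum-swap : ∀ {m n} (c : Fin n → ℤ) (a : Fin m → ℤ) (b : Fin m → Fin n → ℤ) →
  sum (λ x → c x * sum (λ h → a h * b h x)) ≡ sum (λ h → a h * sum (λ x → c x * b h x))
sum-swap {m} {n} c a b = begin
  sum (λ x → c x * sum (λ h → a h * b h x))
    ≡⟨ sum-cong-≗ (λ x → *-distribˡ-sum (c x) (λ h → a h * b h x)) ⟩
  sum (λ x → sum (λ h → c x * (a h * b h x)))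
    ≡⟨ ∑-comm {n} {m} (λ x h → c x * (a h * b h x)) ⟩
  sum (λ h → sum (λ x → c x * (a h * b h x)))
    ≡⟨ sum-cong-≗ (λ h → sum-cong-≗ (λ x → left-comm (c x) (a h) (b h x))) ⟩
  sum (λ h → sum (λ x → a h * (c x * b h x)))
    ≡⟨ sum-cong-≗ (λ h → sym (*-distribˡ-sum (a h) (λ x → c x * b h x))) ⟩
  sum (λ h → a h * sum (λ x → c x * b h x)) ∎
  where
  left-comm : ∀ x y z → x * (y * z) ≡ y * (x * z)
  left-comm = solve-∀

infix 10 _⁎
_⁎ : ∀ {m n} → (Fin m → Fin n) → (Fin m → ℤ) → (Fin n → ℤ)
(f ⁎) A u = sum (λ x → A x * δ (f x) u)

module _ {m n} (f : Fin m → Fin n) where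

  ⁎-adjoint : ∀ (F : Fin n → ℤ) A → sum (λ v → F v * (f ⁎) A v) ≡ sum (λ x → A x * F (f x))
  ⁎-adjoint F A =
    trans (sum-swap F A (λ x v → δ (f x) v)) (sum-cong-≗ λ x → cong (A x *_) (sum-δ (f x) F))

  ⁎-+ : ∀ A B u → (f ⁎) (λ x → A x + B x) u ≡ (f ⁎) A u + (f ⁎) B u
  ⁎-+ A B u = trans (sum-cong-≗ (λ x → ℤP.*-distribʳ-+ (δ (f x) u) (A x) (B x)))
                    (∑-distrib-+ (λ x → A x * δ (f x) u) (λ x → B x * δ (f x) u))

  ⁎-- : ∀ A B u → (f ⁎) (λ x → A x - B x) u ≡ (f ⁎) A u - (f ⁎) B u
  ⁎-- A B u = trans (sum-cong-≗ (λ x → *-distribʳ-- (δ (f x) u) (A x) (B x)))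
                    (∑-distrib-- (λ x → A x * δ (f x) u) (λ x → B x * δ (f x) u))
    where
    *-distribʳ-- : ∀ x y z → (y - z) * x ≡ y * x - z * x
    *-distribʳ-- = solve-∀

  ⁎-* : ∀ k A u → (f ⁎) (λ x → k * A x) u ≡ k * (f ⁎) A u
  ⁎-* k A u = trans (sum-cong-≗ (λ x → ℤP.*-assoc k (A x) (δ (f x) u)))
                    (sym (*-distribˡ-sum k (λ x → A x * δ (f x) u)))

  ⁎-cong : ∀ {g : Fin m → Fin n} → (∀ x → f x ≡ g x) → ∀ A u → (f ⁎) A u ≡ (g ⁎) A u
  ⁎-cong f≗g A u = sum-cong-≗ (λ x → cong (λ y → A x * δ y u) (f≗g x))

⁎-∘ : ∀ {l m n} (g : Fin m → Fin n) (f : Fin l → Fin m) A u → (g ⁎) ((f ⁎) A) u ≡ ((g ∘ f) ⁎) A u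
⁎-∘ g f A u = trans (sum-cong-≗ (λ v → ℤP.*-comm ((f ⁎) A v) (δ (g v) u)))
                    (⁎-adjoint f (λ v → δ (g v) u) A)

⁎-natural : ∀ {m n} (ψ : Fin m → Fin n) {f : Fin m → Fin m} {g : Fin n → Fin n} →
  (∀ x → ψ (f x) ≡ g (ψ x)) → ∀ A u → (ψ ⁎) ((f ⁎) A) u ≡ (g ⁎) ((ψ ⁎) A) u
⁎-natural ψ {f} {g} ψf≗gψ A u = begin
  (ψ ⁎) ((f ⁎) A) u  ≡⟨ ⁎-∘ ψ f A u ⟩
  ((ψ ∘ f) ⁎) A u    ≡⟨ ⁎-cong (ψ ∘ f) ψf≗gψ A u ⟩
  ((g ∘ ψ) ⁎) A u    ≡⟨ sym (⁎-∘ g ψ A u) ⟩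
  (g ⁎) ((ψ ⁎) A) u  ∎

module GroupRingProperties {N} (H : FinAbGroup N) where
  open FinAbGroupProperties H
  open GroupRing H

  ⊛-sum : ∀ A B x → (A ⊛ B) x ≡ sum (λ h → A h * B (h ⁻¹ ∙ x))
  ⊛-sum A B x = sumFin≡sum N _

  sq⁽²⁾-⁎ : ∀ A → sq⁽²⁾ A ≐ ((λ h → h ∙ h) ⁎) A
  sq⁽²⁾-⁎ A g = trans (sumFin≡sum N _) (sum-cong-≗ (λ h → if-≟-δ (h ∙ h) g (A h)))

  inv⁽⁻¹⁾-⁎ : ∀ A → inv⁽⁻¹⁾ A ≐ (_⁻¹ ⁎) A
  inv⁽⁻¹⁾-⁎ A g = sym (trans
    (sum-cong-≗ (λ x → cong (A x *_) (δ-cong x⁻¹≡g⇒g⁻¹≡x g⁻¹≡x⇒x⁻¹≡g)))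
    (sum-δ (g ⁻¹) A))
    where
    x⁻¹≡g⇒g⁻¹≡x : ∀ {x} → x ⁻¹ ≡ g → g ⁻¹ ≡ x
    x⁻¹≡g⇒g⁻¹≡x {x} refl = ⁻¹-involutive x
    g⁻¹≡x⇒x⁻¹≡g : ∀ {x} → g ⁻¹ ≡ x → x ⁻¹ ≡ g
    g⁻¹≡x⇒x⁻¹≡g refl = ⁻¹-involutive g

  ⁎-resp-≐ : ∀ {M} (f : Fin N → Fin M) {A B} → A ≐ B → ∀ u → (f ⁎) A u ≡ (f ⁎) B u
  ⁎-resp-≐ f A≐B u = sum-cong-≗ (λ x → cong (_* δ (f x) u) (A≐B x))

module PushforwardAlong {M N} {H : FinAbGroup M} {G : FinAbGroup N} (ψ : Hom H G) where
  private
    module H = FinAbGroupProperties H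
    module G = FinAbGroupProperties G
    module ℤ[H] = GroupRing H
    module ℤ[G] = GroupRing G
  open Hom ψ
  open HomProperties ψ
  open GroupRingProperties using (⊛-sum; sq⁽²⁾-⁎; inv⁽⁻¹⁾-⁎; ⁎-resp-≐)

  ψ⁎ : ℤ[H].ZH → ℤ[G].ZH
  ψ⁎ = to ⁎

  δ-translate : ∀ a y v → δ (to (a H.∙ y)) v ≡ δ (to y) (to a G.⁻¹ G.∙ v)
  δ-translate a y v = δ-cong
    (λ ψ[ay]≡v → trans (sym (G.\\-leftDividesʳ (to a) (to y)))
                       (cong (to a G.⁻¹ G.∙_) (trans (sym (homo a y)) ψ[ay]≡v)))
    (λ ψy≡a⁻¹v → trans (homo a y) (trans (cong (to a G.∙_) ψy≡a⁻¹v) (G.\\-leftDividesˡ (to a) v)))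

  ⁎-⊛ : ∀ A B → ψ⁎ (A ℤ[H].⊛ B) ℤ[G].≐ (ψ⁎ A ℤ[G].⊛ ψ⁎ B)
  ⁎-⊛ A B u = begin
    sum (λ x → (A ℤ[H].⊛ B) x * δ (to x) u)
      ≡⟨ sum-cong-≗ (λ x → trans (ℤP.*-comm ((A ℤ[H].⊛ B) x) (δ (to x) u))
                                 (cong (δ (to x) u *_) (⊛-sum H A B x))) ⟩
    sum (λ x → δ (to x) u * sum (λ h → A h * B (h H.⁻¹ H.∙ x)))
      ≡⟨ sum-swap (λ x → δ (to x) u) A (λ h x → B (h H.⁻¹ H.∙ x)) ⟩
    sum (λ h → A h * sum (λ x → δ (to x) u * B (h H.⁻¹ H.∙ x)))
      ≡⟨ sum-cong-≗ (λ h → cong (A h *_) (translate h)) ⟩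
    sum (λ h → A h * F (to h))
      ≡⟨ sym (⁎-adjoint to F A) ⟩
    sum (λ v → F v * ψ⁎ A v)
      ≡⟨ sum-cong-≗ (λ v → ℤP.*-comm (F v) (ψ⁎ A v)) ⟩
    sum (λ v → ψ⁎ A v * ψ⁎ B (v G.⁻¹ G.∙ u))
      ≡⟨ sym (⊛-sum G (ψ⁎ A) (ψ⁎ B) u) ⟩
    (ψ⁎ A ℤ[G].⊛ ψ⁎ B) u ∎
    where
    F : Fin N → ℤ
    F v = ψ⁎ B (v G.⁻¹ G.∙ u)
    translate : ∀ h → sum (λ x → δ (to x) u * B (h H.⁻¹ H.∙ x)) ≡ F (to h)
    translate h = begin
      sum (λ x → δ (to x) u * B (h H.⁻¹ H.∙ x))
        ≡⟨ ∑-permute _ (H.translation h) ⟩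
      sum (λ y → δ (to (h H.∙ y)) u * B (h H.⁻¹ H.∙ (h H.∙ y)))
        ≡⟨ sum-cong-≗ (λ y → cong₂ _*_ (δ-translate h y u) (cong B (H.\\-leftDividesʳ h y))) ⟩
      sum (λ y → δ (to y) (to h G.⁻¹ G.∙ u) * B y)
        ≡⟨ sum-cong-≗ (λ y → ℤP.*-comm _ (B y)) ⟩
      F (to h) ∎

  ⁎-sq⁽²⁾ : ∀ A → ψ⁎ (ℤ[H].sq⁽²⁾ A) ℤ[G].≐ ℤ[G].sq⁽²⁾ (ψ⁎ A)
  ⁎-sq⁽²⁾ A u = begin
    ψ⁎ (ℤ[H].sq⁽²⁾ A) u                 ≡⟨ ⁎-resp-≐ H to (sq⁽²⁾-⁎ H A) u ⟩
    ψ⁎ (((λ h → h H.∙ h) ⁎) A) u        ≡⟨ ⁎-natural to {g = λ v → v G.∙ v} (λ h → homo h h) A u ⟩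
    ((λ v → v G.∙ v) ⁎) (ψ⁎ A) u        ≡⟨ sym (sq⁽²⁾-⁎ G (ψ⁎ A) u) ⟩
    ℤ[G].sq⁽²⁾ (ψ⁎ A) u                 ∎

  ⁎-inv⁽⁻¹⁾ : ∀ A → ψ⁎ (ℤ[H].inv⁽⁻¹⁾ A) ℤ[G].≐ ℤ[G].inv⁽⁻¹⁾ (ψ⁎ A)
  ⁎-inv⁽⁻¹⁾ A u = begin
    ψ⁎ (ℤ[H].inv⁽⁻¹⁾ A) u               ≡⟨ ⁎-resp-≐ H to (inv⁽⁻¹⁾-⁎ H A) u ⟩
    ψ⁎ ((H._⁻¹ ⁎) A) u                  ≡⟨ ⁎-natural to {g = G._⁻¹} to-⁻¹ A u ⟩
    (G._⁻¹ ⁎) (ψ⁎ A) u                  ≡⟨ sym (inv⁽⁻¹⁾-⁎ G (ψ⁎ A) u) ⟩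
    ℤ[G].inv⁽⁻¹⁾ (ψ⁎ A) u               ∎

  ⁎-symmetric : ∀ {A} → ℤ[H].inv⁽⁻¹⁾ A ℤ[H].≐ A → ℤ[G].inv⁽⁻¹⁾ (ψ⁎ A) ℤ[G].≐ ψ⁎ A
  ⁎-symmetric {A} A-sym u = trans (sym (⁎-inv⁽⁻¹⁾ A u)) (⁎-resp-≐ H to A-sym u)

  ⁎-δe : ψ⁎ ℤ[H].δe ℤ[G].≐ ℤ[G].δe
  ⁎-δe u = begin
    sum (λ x → δ x H.e * δ (to x) u) ≡⟨ sum-supported _ H.e (λ x x≢e →
                                          trans (cong (_* δ (to x) u) (δ-≢ x≢e)) (ℤP.*-zeroˡ (δ (to x) u))) ⟩
    δ H.e H.e * δ (to H.e) u         ≡⟨ cong (_* δ (to H.e) u) (δ-≡ {x = H.e} refl) ⟩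
    + 1 * δ (to H.e) u               ≡⟨ ℤP.*-identityˡ _ ⟩
    δ (to H.e) u                     ≡⟨ cong (λ y → δ y u) to-e ⟩
    δ G.e u                          ≡⟨ δ-sym G.e u ⟩
    δ u G.e                          ∎

  ⁎-𝟙H-constant : (∀ w → ∃ λ a → to a ≡ w) → ∀ u v → ψ⁎ ℤ[H].𝟙H v ≡ ψ⁎ ℤ[H].𝟙H u
  ⁎-𝟙H-constant surjective u v with a , ψa≡vu⁻¹ ← surjective (v G.∙ u G.⁻¹) = begin
    sum (λ x → + 1 * δ (to x) v)
      ≡⟨ ∑-permute _ (H.translation a) ⟩
    sum (λ y → + 1 * δ (to (a H.∙ y)) v)
      ≡⟨ sum-cong-≗ (λ y → cong (+ 1 *_) (δ-translate a y v)) ⟩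
    sum (λ y → + 1 * δ (to y) (to a G.⁻¹ G.∙ v))
      ≡⟨ sum-cong-≗ (λ y → cong (λ w → + 1 * δ (to y) w) ψa⁻¹v≡u) ⟩
    sum (λ y → + 1 * δ (to y) u) ∎
    where
    ψa⁻¹v≡u : to a G.⁻¹ G.∙ v ≡ u
    ψa⁻¹v≡u = begin
      to a G.⁻¹ G.∙ v              ≡⟨ cong (λ w → w G.⁻¹ G.∙ v) ψa≡vu⁻¹ ⟩
      (v G.∙ u G.⁻¹) G.⁻¹ G.∙ v    ≡⟨ cong (G._∙ v) (G.⁻¹-anti-homo‿- v u) ⟩
      u G.∙ v G.⁻¹ G.∙ v           ≡⟨ G.//-rightDividesˡ v u ⟩
      u                            ∎

xy≡-1⇒x²+y²+x+y≡2 : ∀ x y → x * y ≡ - + 1 → x * x + y * y + x + y ≡ + 2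
xy≡-1⇒x²+y²+x+y≡2 x y xy≡-1 =
  by-cases x (ℕP.m*n≡1⇒m≡1 ℤ.∣ x ∣ ℤ.∣ y ∣ (trans (sym (ℤP.abs-* x y)) (cong ℤ.∣_∣ xy≡-1))) xy≡-1
  where
  by-cases : ∀ x → ℤ.∣ x ∣ ≡ 1 → x * y ≡ - + 1 → x * x + y * y + x + y ≡ + 2
  by-cases (+ 1) _ 1*y≡-1 with refl ← trans (sym (ℤP.*-identityˡ y)) 1*y≡-1 = refl
  by-cases (ℤ.-[1+ 0 ]) _ -1*y≡-1 with refl ← ℤP.neg-injective (trans (sym (ℤP.-1*i≡-i y)) -1*y≡-1) = refl

-- The coordinates at 0 and 1 of both equations, written as they compute; the differences of
-- the two coordinates give x y = -1 and x² + y² + x + y = K for x = X₀ - X₁, y = Y₀ - Y₁.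
coordinates⇒K≡2 : ∀ {X₀ X₁ X₂ Y₀ Y₁ Y₂ C₀ C₁} K → X₂ ≡ X₁ → Y₂ ≡ Y₁ → C₁ ≡ C₀ →
  X₀ * Y₀ + (X₁ * Y₂ + (X₂ * Y₁ + + 0)) ≡ C₀ - + 1 →
  X₀ * Y₁ + (X₁ * Y₀ + (X₂ * Y₂ + + 0)) ≡ C₁ - + 0 →
  X₀ * X₀ + (X₁ * X₂ + (X₂ * X₁ + + 0)) + (Y₀ * Y₀ + (Y₁ * Y₂ + (Y₂ * Y₁ + + 0)))
    ≡ + 2 * C₀ - (X₀ + + 0) - (Y₀ + + 0) + K * + 1 →
  X₀ * X₁ + (X₁ * X₀ + (X₂ * X₂ + + 0)) + (Y₀ * Y₁ + (Y₁ * Y₀ + (Y₂ * Y₂ + + 0)))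
    ≡ + 2 * C₁ - (+ 0 + (+ 0 + (X₂ + + 0))) - (+ 0 + (+ 0 + (Y₂ + + 0))) + K * + 0 →
  K ≡ + 2
coordinates⇒K≡2 {X₀} {X₁} {_} {Y₀} {Y₁} {_} {C₀} K refl refl refl XY₀ XY₁ squares₀ squares₁ =
  trans (sym quadratic) (xy≡-1⇒x²+y²+x+y≡2 (X₀ - X₁) (Y₀ - Y₁) xy≡-1)
  where
  xy≡-1 : (X₀ - X₁) * (Y₀ - Y₁) ≡ - + 1
  xy≡-1 = trans (expand X₀ X₁ Y₀ Y₁) (trans (cong₂ _-_ XY₀ XY₁) (cancel C₀))
    where
    expand : ∀ a b c d → (a - b) * (c - d)
               ≡ (a * c + (b * d + (b * d + + 0))) - (a * d + (b * c + (b * d + + 0)))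
    expand = solve-∀
    cancel : ∀ c → (c - + 1) - (c - + 0) ≡ - + 1
    cancel = solve-∀
  quadratic : (X₀ - X₁) * (X₀ - X₁) + (Y₀ - Y₁) * (Y₀ - Y₁) + (X₀ - X₁) + (Y₀ - Y₁) ≡ K
  quadratic = trans (expand X₀ X₁ Y₀ Y₁)
    (trans (cong (λ t → t + (X₀ - X₁) + (Y₀ - Y₁)) (cong₂ _-_ squares₀ squares₁)) (cancel X₀ X₁ Y₀ Y₁ C₀ K))
    where
    expand : ∀ a b c d → (a - b) * (a - b) + (c - d) * (c - d) + (a - b) + (c - d)
      ≡ (a * a + (b * b + (b * b + + 0)) + (c * c + (d * d + (d * d + + 0))))
        - (a * b + (b * a + (b * b + + 0)) + (c * d + (d * c + (d * d + + 0)))) + (a - b) + (c - d)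
    expand = solve-∀
    cancel : ∀ a b c d e k → (+ 2 * e - (a + + 0) - (c + + 0) + k * + 1)
      - (+ 2 * e - (+ 0 + (+ 0 + (b + + 0))) - (+ 0 + (+ 0 + (d + + 0))) + k * + 0) + (a - b) + (c - d) ≡ k
    cancel = solve-∀

module _ where
  open GroupRing ℤ₃

  ℤ₃-equations⇒K≡2 : ∀ (X Y C : ZH) K → inv⁽⁻¹⁾ X ≐ X → inv⁽⁻¹⁾ Y ≐ Y → C 1F ≡ C 0F →
    (X ⊛ Y) ≐ (C ⊖ δe) →
    ((X ⊛ X) ⊕ (Y ⊛ Y)) ≐ ((((+ 2 · C) ⊖ sq⁽²⁾ X) ⊖ sq⁽²⁾ Y) ⊕ (K · δe)) →
    K ≡ + 2
  ℤ₃-equations⇒K≡2 X Y C K X-sym Y-sym C₁≡C₀ XY≐ squares≐ =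
    coordinates⇒K≡2 {X 0F} {X 1F} {X 2F} {Y 0F} {Y 1F} {Y 2F} {C 0F} {C 1F} K
      (X-sym 1F) (Y-sym 1F) C₁≡C₀ (XY≐ 0F) (XY≐ 1F) (squares≐ 0F) (squares≐ 1F)

module _ {N} {H : FinAbGroup N} (ψ : Hom H ℤ₃) where
  open GroupRing H
  open PushforwardAlong ψ
  private module ℤ[ℤ₃] = GroupRing ℤ₃

  descend-product : ∀ X Y → (X ⊛ Y) ≐ (𝟙H ⊖ δe) →
    (ψ⁎ X ℤ[ℤ₃].⊛ ψ⁎ Y) ℤ[ℤ₃].≐ (ψ⁎ 𝟙H ℤ[ℤ₃].⊖ ℤ[ℤ₃].δe)
  descend-product X Y XY≐ u = begin
    (ψ⁎ X ℤ[ℤ₃].⊛ ψ⁎ Y) u   ≡⟨ sym (⁎-⊛ X Y u) ⟩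
    ψ⁎ (X ⊛ Y) u            ≡⟨ ⁎-resp-≐ H (Hom.to ψ) XY≐ u ⟩
    ψ⁎ (𝟙H ⊖ δe) u          ≡⟨ ⁎-- (Hom.to ψ) 𝟙H δe u ⟩
    ψ⁎ 𝟙H u - ψ⁎ δe u       ≡⟨ cong (_-_ (ψ⁎ 𝟙H u)) (⁎-δe u) ⟩
    ψ⁎ 𝟙H u - ℤ[ℤ₃].δe u    ∎
    where open GroupRingProperties using (⁎-resp-≐)

  descend-squares : ∀ X Y K →
    ((X ⊛ X) ⊕ (Y ⊛ Y)) ≐ ((((+ 2 · 𝟙H) ⊖ sq⁽²⁾ X) ⊖ sq⁽²⁾ Y) ⊕ (K · δe)) →
    ((ψ⁎ X ℤ[ℤ₃].⊛ ψ⁎ X) ℤ[ℤ₃].⊕ (ψ⁎ Y ℤ[ℤ₃].⊛ ψ⁎ Y))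
      ℤ[ℤ₃].≐ ((((+ 2 ℤ[ℤ₃].· ψ⁎ 𝟙H) ℤ[ℤ₃].⊖ ℤ[ℤ₃].sq⁽²⁾ (ψ⁎ X)) ℤ[ℤ₃].⊖ ℤ[ℤ₃].sq⁽²⁾ (ψ⁎ Y))
                ℤ[ℤ₃].⊕ (K ℤ[ℤ₃].· ℤ[ℤ₃].δe))
  descend-squares X Y K squares≐ u = begin
    (ψ⁎ X ℤ[ℤ₃].⊛ ψ⁎ X) u + (ψ⁎ Y ℤ[ℤ₃].⊛ ψ⁎ Y) u
      ≡⟨ sym (cong₂ _+_ (⁎-⊛ X X u) (⁎-⊛ Y Y u)) ⟩
    ψ⁎ (X ⊛ X) u + ψ⁎ (Y ⊛ Y) u
      ≡⟨ sym (⁎-+ f (X ⊛ X) (Y ⊛ Y) u) ⟩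
    ψ⁎ ((X ⊛ X) ⊕ (Y ⊛ Y)) u
      ≡⟨ ⁎-resp-≐ H f squares≐ u ⟩
    ψ⁎ ((((+ 2 · 𝟙H) ⊖ sq⁽²⁾ X) ⊖ sq⁽²⁾ Y) ⊕ (K · δe)) u
      ≡⟨ ⁎-+ f (((+ 2 · 𝟙H) ⊖ sq⁽²⁾ X) ⊖ sq⁽²⁾ Y) (K · δe) u ⟩
    ψ⁎ (((+ 2 · 𝟙H) ⊖ sq⁽²⁾ X) ⊖ sq⁽²⁾ Y) u + ψ⁎ (K · δe) u
      ≡⟨ cong₂ _+_ (trans (⁎-- f ((+ 2 · 𝟙H) ⊖ sq⁽²⁾ X) (sq⁽²⁾ Y) u)
                          (cong (_- ψ⁎ (sq⁽²⁾ Y) u) (⁎-- f (+ 2 · 𝟙H) (sq⁽²⁾ X) u)))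
                   (⁎-* f K δe u) ⟩
    ψ⁎ (+ 2 · 𝟙H) u - ψ⁎ (sq⁽²⁾ X) u - ψ⁎ (sq⁽²⁾ Y) u + K * ψ⁎ δe u
      ≡⟨ cong₂ _+_ (cong₂ _-_ (cong₂ _-_ (⁎-* f (+ 2) 𝟙H u) (⁎-sq⁽²⁾ X u)) (⁎-sq⁽²⁾ Y u))
                   (cong (K *_) (⁎-δe u)) ⟩
    + 2 * ψ⁎ 𝟙H u - ℤ[ℤ₃].sq⁽²⁾ (ψ⁎ X) u - ℤ[ℤ₃].sq⁽²⁾ (ψ⁎ Y) u + K * ℤ[ℤ₃].δe u ∎
    where
    open GroupRingProperties using (⁎-resp-≐)
    f : Fin N → Fin 3
    f = Hom.to ψ

n²+n+1≡3m : ∀ n → n ℕ.% 6 ≡ 1 → ∃ λ m → n ℕ.* n ℕ.+ n ℕ.+ 1 ≡ 3 ℕ.* m × m ℕ.% 3 ≡ 1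
n²+n+1≡3m n n%6≡1 = 1 ℕ.+ k ℕ.* 3 , N≡3m , [m+kn]%n≡m%n 1 k 3
  where
  t k : ℕ
  t = n ℕ./ 6
  k = 4 ℕ.* t ℕ.* t ℕ.+ 2 ℕ.* t
  n≡1+6t : n ≡ 1 ℕ.+ t ℕ.* 6
  n≡1+6t = trans (m≡m%n+[m/n]*n n 6) (cong (ℕ._+ t ℕ.* 6) n%6≡1)
  identity : ∀ t → (1 ℕ.+ t ℕ.* 6) ℕ.* (1 ℕ.+ t ℕ.* 6) ℕ.+ (1 ℕ.+ t ℕ.* 6) ℕ.+ 1
               ≡ 3 ℕ.* (1 ℕ.+ (4 ℕ.* t ℕ.* t ℕ.+ 2 ℕ.* t) ℕ.* 3)
  identity = ℕ-solve-∀
  N≡3m : n ℕ.* n ℕ.+ n ℕ.+ 1 ≡ 3 ℕ.* (1 ℕ.+ k ℕ.* 3)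
  N≡3m = trans (cong (λ z → z ℕ.* z ℕ.+ z ℕ.+ 1) n≡1+6t) (identity t)

proposition7p2 : (n : ℕ) → 83 ℕ.≤ n → n ℕ.% 5 ≡ 4 → n ℕ.% 6 ≡ 1 →
    (H : FinAbGroup (n ℕ.* n ℕ.+ n ℕ.+ 1)) →
    let open GroupRing H in
    ¬ (∃₂ λ (T₀ T₁ : Subset (n ℕ.* n ℕ.+ n ℕ.+ 1)) →
         InverseClosed T₀ × InverseClosed T₁ × T₀ ∋e ×
         ((⟦ T₀ ⟧ ⊛ ⟦ T₁ ⟧) ≐ (𝟙H ⊖ δe)) ×
         (((⟦ T₀ ⟧ ⊛ ⟦ T₀ ⟧) ⊕ (⟦ T₁ ⟧ ⊛ ⟦ T₁ ⟧))
           ≐ ((((+ 2 · 𝟙H) ⊖ sq⁽²⁾ ⟦ T₀ ⟧) ⊖ sq⁽²⁾ ⟦ T₁ ⟧) ⊕ ((+ (2 ℕ.* n)) · δe))))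
proposition7p2 n 83≤n _ n%6≡1 H (T₀ , T₁ , T₀-closed , T₁-closed , _ , product≐ , squares≐) =
  contradiction (subst (83 ℕ.≤_) n≡1 83≤n) λ { (ℕ.s≤s ()) }
  where
  open GroupRing H
  decomposition : ∃ λ m → n ℕ.* n ℕ.+ n ℕ.+ 1 ≡ 3 ℕ.* m × m ℕ.% 3 ≡ 1
  decomposition = n²+n+1≡3m n n%6≡1
  open ProjectionOntoℤ₃ H {proj₁ decomposition} (proj₁ (proj₂ decomposition))
                                                (proj₂ (proj₂ decomposition))
    using (projection; projection-surjective)
  open PushforwardAlong projection
  2n≡2 : + (2 ℕ.* n) ≡ + 2
  2n≡2 = ℤ₃-equations⇒K≡2 (ψ⁎ ⟦ T₀ ⟧) (ψ⁎ ⟦ T₁ ⟧) (ψ⁎ 𝟙H) (+ (2 ℕ.* n))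
    (⁎-symmetric T₀-closed) (⁎-symmetric T₁-closed) (⁎-𝟙H-constant projection-surjective 0F 1F)
    (descend-product projection ⟦ T₀ ⟧ ⟦ T₁ ⟧ product≐)
    (descend-squares projection ⟦ T₀ ⟧ ⟦ T₁ ⟧ (+ (2 ℕ.* n)) squares≐)
  n≡1 : n ≡ 1
  n≡1 = ℕP.*-cancelˡ-≡ n 1 2 (ℤP.+-injective 2n≡2)
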